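{- Let $p$ be a prime and let $\alpha,\beta$ be positive integers with $\beta$ odd, and put $n=2^{\alpha}p^{\beta}$. Then $n$ is a Zumkeller number if and only if $\sigma(n)\geq 2n$.
   Context: $\sigma(n)$ denotes the sum of the positive divisors of $n$. A positive integer $n$ is a Zumkeller number if the set of its positive divisors can be partitioned into two disjoint subsets with equal sums. -}

module Defs where

open import Data.Nat using (ℕ; suc; _+_; _*_)
open import Data.Nat.Divisibility using (_∣?_)
open import Data.List using (List; []; _∷_; filter; upTo; drop)
open import Data.Nat.ListAction using (sum)
open import Data.Bool using (Bool; true; false; if_then_else_)
open import Data.Product using (Σ)
open import Relation.Binary.PropositionalEquality using (_≡_)

divisors : ℕ → List ℕ
divisors n = filter (_∣? n) (drop 1 (upTo (suc n)))

σ : ℕ → ℕ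
σ n = sum (divisors n)

sumWhere : (ℕ → Bool) → Bool → List ℕ → ℕ
sumWhere c b [] = 0
sumWhere c true  (d ∷ ds) = (if c d then d else 0) + sumWhere c true ds
sumWhere c false (d ∷ ds) = (if c d then 0 else d) + sumWhere c false ds

-- n is Zumkeller iff the set of its positive divisors can be split into two
-- disjoint subsets (the divisors d with c d = true, and those with c d = false)
-- having equal sums.
Zumkeller : ℕ → Set
Zumkeller n = Σ (ℕ → Bool) λ c → sumWhere c true (divisors n) ≡ sumWhere c false (divisors n)

Odd : ℕ → Set
Odd n = Σ ℕ λ k → n ≡ 1 + 2 * k

-- (⇒) holds for every n: the half of a Zumkeller partition containing n is σ(n)/2.
-- (⇐) σ(2^m) = 2^(m+1) − 1 rules out p = 2, and for odd p ≥ 2^(α+1) one has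
-- σ(n) < 2n; so p is odd and p < 2^(α+1).  Let M = σ(2^α), p = 1 + 2h,
-- T = M(1 + h), S = 1 + p² + … + p^(β−1).  Pairing the exponents 2t, 2t+1 of p
-- gives σ(n) = M(1 + p)S = 2TS.  Divide T = Xp + Y with Y < p; then X, Y < 2^(α+1).
-- Put 2^i p^j into the first half iff the i-th binary digit of Y (j even) or of
-- X (j odd) is 1; that half sums to (Y + Xp)S = TS = σ(n)/2.
module Submission where

open import Defs
open import Data.Nat using (ℕ; suc; _*_; _^_; _≥_)
open import Data.Nat.Primality using (Prime)
open import Function.Bundles using (_⇔_)

open import Data.Bool using (Bool; true; false; if_then_else_)
open import Data.Empty using (⊥-elim)
open import Data.List using (List; []; _∷_; map; applyUpTo; upTo; cartesianProductWith; _++_)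
open import Data.List.Membership.Propositional using (_∈_)
open import Data.List.Membership.Propositional.Properties
  using (∈-filter⁺; ∈-filter⁻; ∈-applyUpTo⁺; ∈-upTo⁺; ∈-upTo⁻; ∈-cartesianProductWith⁺; ∈-cartesianProductWith⁻)
open import Data.List.Membership.Propositional.Properties.WithK using (unique∧set⇒bag)
open import Data.List.Properties using (map-++; map-∘; map-id)
open import Data.List.Relation.Binary.BagAndSetEquality using (∼bag⇒↭)
import Data.List.Relation.Binary.Permutation.Propositional.Properties as Perm
open import Data.List.Relation.Unary.Any using (here; there)
open import Data.List.Relation.Unary.Unique.Propositional using (Unique)
import Data.List.Relation.Unary.Unique.Propositional.Properties as Unique
open import Data.Nat
open import Data.Nat.Coprimality using (Coprime; coprime-divisor)
open import Data.Nat.Divisibility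
open import Data.Nat.DivMod
open import Data.Nat.ListAction using (sum)
open import Data.Nat.ListAction.Properties using (sum-↭; sum-++)
open import Data.Nat.Primality
open import Data.Nat.Properties
open import Algebra.Properties.CommutativeSemigroup +-commutativeSemigroup using (interchange)
open import Data.Nat.Tactic.RingSolver using (solve-∀)
open import Data.Product using (∃; _×_; _,_; proj₂)
open import Data.Sum using (inj₁; inj₂)
open import Function.Base using (_∘_)
open import Function.Bundles using (mk⇔)
open import Relation.Binary.Definitions using (tri<; tri≈; tri>)
open import Relation.Binary.PropositionalEquality
open import Relation.Nullary using (¬_; yes; no)
open import Relation.Nullary.Decidable using (from-yes)

sumBelow : ℕ → (ℕ → ℕ) → ℕ
sumBelow zero    f = 0
sumBelow (suc m) f = f 0 + sumBelow m (f ∘ suc)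

infixr 5 sumBelow
syntax sumBelow m (λ i → e) = ∑[ i < m ] e

∑-cong : ∀ m {f g : ℕ → ℕ} → (∀ i → f i ≡ g i) → sumBelow m f ≡ sumBelow m g
∑-cong zero    f≗g = refl
∑-cong (suc m) f≗g = cong₂ _+_ (f≗g 0) (∑-cong m (f≗g ∘ suc))

∑-distrib-+ : ∀ m (f g : ℕ → ℕ) → ∑[ i < m ] (f i + g i) ≡ sumBelow m f + sumBelow m g
∑-distrib-+ zero    f g = refl
∑-distrib-+ (suc m) f g =
  trans (cong (f 0 + g 0 +_) (∑-distrib-+ m (f ∘ suc) (g ∘ suc)))
        (interchange (f 0) (g 0) (sumBelow m (f ∘ suc)) (sumBelow m (g ∘ suc)))

∑-*ˡ : ∀ m c (f : ℕ → ℕ) → ∑[ i < m ] c * f i ≡ c * sumBelow m f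
∑-*ˡ zero    c f = sym (*-zeroʳ c)
∑-*ˡ (suc m) c f = trans (cong (c * f 0 +_) (∑-*ˡ m c (f ∘ suc))) (sym (*-distribˡ-+ c (f 0) _))

∑-*ʳ : ∀ m c (f : ℕ → ℕ) → ∑[ i < m ] f i * c ≡ sumBelow m f * c
∑-*ʳ m c f = trans (∑-cong m (λ i → *-comm (f i) c)) (trans (∑-*ˡ m c f) (*-comm c _))

∑-affine : ∀ m (u v : ℕ → ℕ) x s →
           ∑[ i < m ] (u i + v i * x) * s ≡ (sumBelow m u + sumBelow m v * x) * s
∑-affine m u v x s = begin
    ∑[ i < m ] (u i + v i * x) * s
  ≡⟨ ∑-*ʳ m s (λ i → u i + v i * x) ⟩
    (∑[ i < m ] (u i + v i * x)) * s
  ≡⟨ cong (_* s) (∑-distrib-+ m u (λ i → v i * x)) ⟩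
    (sumBelow m u + (∑[ i < m ] v i * x)) * s
  ≡⟨ cong (λ t → (sumBelow m u + t) * s) (∑-*ʳ m x v) ⟩
    (sumBelow m u + sumBelow m v * x) * s ∎
  where open ≡-Reasoning

sum-applyUpTo : ∀ (h g : ℕ → ℕ) m → sum (map h (applyUpTo g m)) ≡ ∑[ i < m ] h (g i)
sum-applyUpTo h g zero    = refl
sum-applyUpTo h g (suc m) = cong (h (g 0) +_) (sum-applyUpTo h (g ∘ suc) m)

sum-cartesianProductWith : ∀ (h : ℕ → ℕ) (F : ℕ → ℕ → ℕ) xs ys →
  sum (map h (cartesianProductWith F xs ys)) ≡ sum (map (λ x → sum (map (h ∘ F x) ys)) xs)
sum-cartesianProductWith h F []       ys = refl
sum-cartesianProductWith h F (x ∷ xs) ys = begin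
    sum (map h (map (F x) ys ++ cartesianProductWith F xs ys))
  ≡⟨ cong sum (map-++ h (map (F x) ys) _) ⟩
    sum (map h (map (F x) ys) ++ map h (cartesianProductWith F xs ys))
  ≡⟨ sum-++ (map h (map (F x) ys)) _ ⟩
    sum (map h (map (F x) ys)) + sum (map h (cartesianProductWith F xs ys))
  ≡⟨ cong₂ _+_ (cong sum (sym (map-∘ ys))) (sum-cartesianProductWith h F xs ys) ⟩
    sum (map (h ∘ F x) ys) + sum (map (λ x → sum (map (h ∘ F x) ys)) xs) ∎
  where open ≡-Reasoning

sum-grid : ∀ (h : ℕ → ℕ) (F : ℕ → ℕ → ℕ) a b →
  sum (map h (cartesianProductWith F (upTo a) (upTo b))) ≡ ∑[ i < a ] ∑[ j < b ] h (F i j)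
sum-grid h F a b = begin
    sum (map h (cartesianProductWith F (upTo a) (upTo b)))
  ≡⟨ sum-cartesianProductWith h F (upTo a) (upTo b) ⟩
    sum (map (λ i → sum (map (h ∘ F i) (upTo b))) (upTo a))
  ≡⟨ sum-applyUpTo _ (λ i → i) a ⟩
    ∑[ i < a ] sum (map (h ∘ F i) (upTo b))
  ≡⟨ ∑-cong a (λ i → sum-applyUpTo (h ∘ F i) (λ j → j) b) ⟩
    ∑[ i < a ] ∑[ j < b ] h (F i j) ∎
  where open ≡-Reasoning

geom : ℕ → ℕ → ℕ
geom q m = ∑[ j < m ] q ^ j

geom-suc : ∀ q m → geom q (suc m) ≡ 1 + q * geom q m
geom-suc q m = cong (1 +_) (∑-*ˡ m q (q ^_))

-- (1 + p + … + p^(m−1))(p − 1) = p^m − 1, written without subtraction (p = q + 1).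
geom-closed : ∀ q m → geom (suc q) m * q + 1 ≡ suc q ^ m
geom-closed q zero    = refl
geom-closed q (suc m) = begin
    geom (suc q) (suc m) * q + 1
  ≡⟨ cong (λ g → g * q + 1) (geom-suc (suc q) m) ⟩
    (1 + suc q * geom (suc q) m) * q + 1
  ≡⟨ factor q (geom (suc q) m) ⟩
    suc q * (geom (suc q) m * q + 1)
  ≡⟨ cong (suc q *_) (geom-closed q m) ⟩
    suc q ^ suc m ∎
  where
  open ≡-Reasoning
  factor : ∀ q g → (1 + suc q * g) * q + 1 ≡ suc q * (g * q + 1)
  factor = solve-∀

geom-two : ∀ m → geom 2 m + 1 ≡ 2 ^ m
geom-two m = trans (cong (_+ 1) (sym (*-identityʳ (geom 2 m)))) (geom-closed 1 m)

∑-period-two : ∀ p (w : ℕ → ℕ) → (∀ j → w (2 + j) ≡ w j) → ∀ k →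
               ∑[ j < 2 + 2 * k ] w j * p ^ j ≡ (w 0 + w 1 * p) * geom (p * p) (suc k)
∑-period-two p w period zero = base (w 0) (w 1) p
  where
  base : ∀ u v p → u * 1 + (v * (p * 1) + 0) ≡ (u + v * p) * (1 + 0)
  base = solve-∀
∑-period-two p w period (suc k) = begin
    ∑[ j < 2 + 2 * suc k ] w j * p ^ j
  ≡⟨ cong (λ m → ∑[ j < 2 + m ] w j * p ^ j) (*-suc 2 k) ⟩
    w 0 * 1 + (w 1 * (p * 1) + (∑[ j < 2 + 2 * k ] w (2 + j) * p ^ (2 + j)))
  ≡⟨ cong (λ t → w 0 * 1 + (w 1 * (p * 1) + t)) shifted ⟩
    w 0 * 1 + (w 1 * (p * 1) + p * p * ((w 0 + w 1 * p) * geom (p * p) (suc k)))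
  ≡⟨ regroup (w 0) (w 1) p (geom (p * p) (suc k)) ⟩
    (w 0 + w 1 * p) * (1 + p * p * geom (p * p) (suc k))
  ≡⟨ cong ((w 0 + w 1 * p) *_) (sym (geom-suc (p * p) (suc k))) ⟩
    (w 0 + w 1 * p) * geom (p * p) (suc (suc k)) ∎
  where
  open ≡-Reasoning
  shift : ∀ u p x → u * (p * (p * x)) ≡ p * p * (u * x)
  shift = solve-∀
  regroup : ∀ u v p s → u * 1 + (v * (p * 1) + p * p * ((u + v * p) * s)) ≡ (u + v * p) * (1 + p * p * s)
  regroup = solve-∀
  shifted : ∑[ j < 2 + 2 * k ] w (2 + j) * p ^ (2 + j)
          ≡ p * p * ((w 0 + w 1 * p) * geom (p * p) (suc k))
  shifted = begin
      ∑[ j < 2 + 2 * k ] w (2 + j) * p ^ (2 + j)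
    ≡⟨ ∑-cong (2 + 2 * k) (λ j → trans (cong (_* p ^ (2 + j)) (period j)) (shift (w j) p (p ^ j))) ⟩
      ∑[ j < 2 + 2 * k ] p * p * (w j * p ^ j)
    ≡⟨ ∑-*ˡ (2 + 2 * k) (p * p) (λ j → w j * p ^ j) ⟩
      p * p * (∑[ j < 2 + 2 * k ] w j * p ^ j)
    ≡⟨ cong (p * p *_) (∑-period-two p w period k) ⟩
      p * p * ((w 0 + w 1 * p) * geom (p * p) (suc k)) ∎

select : Bool → ℕ → ℕ
select b x = if b then x else 0

select-*ˡ : ∀ b c x → select b (c * x) ≡ c * select b x
select-*ˡ true  c x = refl
select-*ˡ false c x = sym (*-zeroʳ c)

select-*ʳ : ∀ b x c → select b (x * c) ≡ select b x * c
select-*ʳ true  x c = refl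
select-*ʳ false x c = refl

sumWhere-true : ∀ c L → sumWhere c true L ≡ sum (map (λ d → select (c d) d) L)
sumWhere-true c []      = refl
sumWhere-true c (d ∷ L) = cong (select (c d) d +_) (sumWhere-true c L)

sumWhere-split : ∀ c L → sumWhere c true L + sumWhere c false L ≡ sum L
sumWhere-split c [] = refl
sumWhere-split c (d ∷ L) with c d
... | true  = trans (+-assoc d _ _) (cong (d +_) (sumWhere-split c L))
... | false = begin
    t + (d + f) ≡⟨ x+[y+z]≡y+[x+z] t d f ⟩
    d + (t + f) ≡⟨ cong (d +_) (sumWhere-split c L) ⟩
    d + sum L   ∎
  where
  open ≡-Reasoning
  t f : ℕ
  t = sumWhere c true L
  f = sumWhere c false L
  x+[y+z]≡y+[x+z] : ∀ x y z → x + (y + z) ≡ y + (x + z)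
  x+[y+z]≡y+[x+z] = solve-∀

member-≤-part : ∀ c {x} L → x ∈ L → x ≤ sumWhere c (c x) L
member-≤-part c (x ∷ L) (here refl) with c x in cx
... | true  rewrite cx = m≤m+n x _
... | false rewrite cx = m≤m+n x _
member-≤-part c {x} (d ∷ L) (there x∈L) with c x | member-≤-part c L x∈L
... | true  | x≤part = ≤-trans x≤part (m≤n+m _ _)
... | false | x≤part = ≤-trans x≤part (m≤n+m _ _)

equal-parts⇒half : ∀ c L → sumWhere c true L ≡ sumWhere c false L →
                   ∀ b → 2 * sumWhere c b L ≡ sum L
equal-parts⇒half c L t≡f true = begin
    2 * t  ≡⟨ cong (t +_) (+-identityʳ t) ⟩
    t + t  ≡⟨ cong (t +_) t≡f ⟩
    t + f  ≡⟨ sumWhere-split c L ⟩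
    sum L  ∎
  where
  open ≡-Reasoning
  t f : ℕ
  t = sumWhere c true L
  f = sumWhere c false L
equal-parts⇒half c L t≡f false = begin
    2 * f  ≡⟨ cong (f +_) (+-identityʳ f) ⟩
    f + f  ≡⟨ cong (_+ f) (sym t≡f) ⟩
    t + f  ≡⟨ sumWhere-split c L ⟩
    sum L  ∎
  where
  open ≡-Reasoning
  t f : ℕ
  t = sumWhere c true L
  f = sumWhere c false L

n∈divisors : ∀ n .{{_ : NonZero n}} → n ∈ divisors n
n∈divisors (suc m) = ∈-filter⁺ (_∣? suc m) (∈-applyUpTo⁺ suc ≤-refl) ∣-refl

-- Every Zumkeller number is abundant or perfect: the part containing n is σ(n)/2.
zumkeller⇒abundant : ∀ n .{{_ : NonZero n}} → Zumkeller n → σ n ≥ 2 * n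
zumkeller⇒abundant n (c , t≡f) = begin
    2 * n                             ≤⟨ *-monoʳ-≤ 2 (member-≤-part c (divisors n) (n∈divisors n)) ⟩
    2 * sumWhere c (c n) (divisors n) ≡⟨ equal-parts⇒half c (divisors n) t≡f (c n) ⟩
    σ n                               ∎
  where open ≤-Reasoning

half-part⇒zumkeller : ∀ n c → 2 * sumWhere c true (divisors n) ≡ σ n → Zumkeller n
half-part⇒zumkeller n c 2t≡σ = c , sym (+-cancelˡ-≡ t f t (begin
    t + f  ≡⟨ sumWhere-split c (divisors n) ⟩
    σ n    ≡⟨ 2t≡σ ⟨
    2 * t  ≡⟨ cong (t +_) (+-identityʳ t) ⟩
    t + t  ∎))
  where
  open ≡-Reasoning
  t f : ℕ
  t = sumWhere c true (divisors n)
  f = sumWhere c false (divisors n)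

coprime-to-prime : ∀ {p d} → Prime p → ¬ p ∣ d → Coprime d p
coprime-to-prime p-prime p∤d (i∣d , i∣p) with prime⇒irreducible p-prime i∣p
... | inj₁ i≡1 = i≡1
... | inj₂ refl = ⊥-elim (p∤d i∣d)

prime-power-divisor : ∀ {p} → Prime p → ∀ b {d} → d ∣ p ^ b → ∃ λ j → j ≤ b × d ≡ p ^ j
prime-power-divisor p-prime zero d∣1 = 0 , z≤n , ∣1⇒≡1 d∣1
prime-power-divisor {p} p-prime (suc b) {d} d∣p^b with p ∣? d
... | no p∤d =
  let j , j≤b , d≡p^j = prime-power-divisor p-prime b (coprime-divisor (coprime-to-prime p-prime p∤d) d∣p^b)
  in j , m≤n⇒m≤1+n j≤b , d≡p^j
... | yes (divides e refl) =
  let instance _ = prime⇒nonZero p-prime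
      e∣p^b = *-cancelˡ-∣ p (subst (_∣ p * p ^ b) (*-comm e p) d∣p^b)
      j , j≤b , e≡p^j = prime-power-divisor p-prime b e∣p^b
  in suc j , s≤s j≤b , trans (*-comm e p) (cong (p *_) e≡p^j)

two-prime-powers-divisor : ∀ {q p} → Prime q → Prime p → ∀ a b {d} → d ∣ q ^ a * p ^ b →
                           ∃ λ i → ∃ λ j → i ≤ a × j ≤ b × d ≡ q ^ i * p ^ j
two-prime-powers-divisor {q} {p} q-prime p-prime zero b {d} d∣p^b =
  let j , j≤b , d≡p^j = prime-power-divisor p-prime b (subst (d ∣_) (*-identityˡ _) d∣p^b)
  in 0 , j , z≤n , j≤b , trans d≡p^j (sym (*-identityˡ _))
two-prime-powers-divisor {q} {p} q-prime p-prime (suc a) b {d} d∣n with q ∣? d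
... | no q∤d =
  let i , j , i≤a , j≤b , d≡q^ip^j = two-prime-powers-divisor q-prime p-prime a b
        (coprime-divisor (coprime-to-prime q-prime q∤d) (subst (d ∣_) (*-assoc q (q ^ a) (p ^ b)) d∣n))
  in i , j , m≤n⇒m≤1+n i≤a , j≤b , d≡q^ip^j
... | yes (divides e refl) =
  let instance _ = prime⇒nonZero q-prime
      e∣q^ap^b = *-cancelˡ-∣ q (subst₂ _∣_ (*-comm e q) (*-assoc q (q ^ a) (p ^ b)) d∣n)
      i , j , i≤a , j≤b , e≡q^ip^j = two-prime-powers-divisor q-prime p-prime a b e∣q^ap^b
  in suc i , j , s≤s i≤a , j≤b ,
     trans (*-comm e q) (trans (cong (q *_) e≡q^ip^j) (sym (*-assoc q (q ^ i) (p ^ j))))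

odd-prime : ∀ {p} → Prime p → p ≢ 2 → p % 2 ≡ 1
odd-prime {p} p-prime p≢2 with p % 2 in p%2 | m%n<n p 2
... | 0 | _ with prime⇒irreducible p-prime (m%n≡0⇒n∣m p 2 p%2)
...   | inj₂ 2≡p = ⊥-elim (p≢2 (sym 2≡p))
odd-prime p-prime p≢2 | 1 | _ = refl
odd-prime p-prime p≢2 | suc (suc _) | s≤s (s≤s ())

odd-power : ∀ {o} → o % 2 ≡ 1 → ∀ j → o ^ j % 2 ≡ 1
odd-power o-odd zero = refl
odd-power {o} o-odd (suc j) =
  trans (%-distribˡ-* o (o ^ j) 2) (cong₂ (λ x y → (x * y) % 2) o-odd (odd-power o-odd j))

double≢odd : ∀ x y → y % 2 ≡ 1 → 2 * x ≢ y
double≢odd x y y-odd refl with trans (sym y-odd) (trans (cong (_% 2) (*-comm 2 x)) (m*n%n≡0 x 2))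
... | ()

power-injective : ∀ {o} → 1 < o → ∀ {j j'} → o ^ j ≡ o ^ j' → j ≡ j'
power-injective {o} 1<o {j} {j'} eq with <-cmp j j'
... | tri< j<j' _ _ = ⊥-elim (<-irrefl eq (^-monoʳ-< o 1<o j<j'))
... | tri≈ _ j≡j' _ = j≡j'
... | tri> _ _ j>j' = ⊥-elim (<-irrefl (sym eq) (^-monoʳ-< o 1<o j>j'))

power-divides : ∀ m {i a} → i ≤ a → m ^ i ∣ m ^ a
power-divides m {a = a} z≤n       = 1∣ (m ^ a)
power-divides m         (s≤s i≤a) = *-monoʳ-∣ m (power-divides m i≤a)

two-odd-powers-injective : ∀ {o} → 1 < o → o % 2 ≡ 1 →
                           ∀ i i' j j' → 2 ^ i * o ^ j ≡ 2 ^ i' * o ^ j' → i ≡ i' × j ≡ j'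
two-odd-powers-injective {o} 1<o o-odd zero zero j j' eq =
  refl , power-injective 1<o (trans (sym (*-identityˡ _)) (trans eq (*-identityˡ _)))
two-odd-powers-injective {o} 1<o o-odd zero (suc i') j j' eq =
  ⊥-elim (double≢odd (2 ^ i' * o ^ j') (o ^ j) (odd-power o-odd j)
           (trans (sym (*-assoc 2 (2 ^ i') (o ^ j'))) (trans (sym eq) (*-identityˡ _))))
two-odd-powers-injective {o} 1<o o-odd (suc i) zero j j' eq =
  ⊥-elim (double≢odd (2 ^ i * o ^ j) (o ^ j') (odd-power o-odd j')
           (trans (sym (*-assoc 2 (2 ^ i) (o ^ j))) (trans eq (*-identityˡ _))))
two-odd-powers-injective {o} 1<o o-odd (suc i) (suc i') j j' eq =
  let i≡i' , j≡j' = two-odd-powers-injective 1<o o-odd i i' j j'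
                      (*-cancelˡ-≡ _ _ 2 (trans (sym (*-assoc 2 (2 ^ i) (o ^ j)))
                                                (trans eq (*-assoc 2 (2 ^ i') (o ^ j')))))
  in cong suc i≡i' , j≡j'

-- Summing any h over the divisors of 2^a p^b (p an odd prime) is a double sum
-- over the exponents, since the divisors are exactly the 2^i p^j, i ≤ a, j ≤ b,
-- each occurring once.
sum-over-divisors : ∀ {p} → Prime p → p % 2 ≡ 1 → ∀ a b (h : ℕ → ℕ) →
  sum (map h (divisors (2 ^ a * p ^ b))) ≡ ∑[ i < suc a ] ∑[ j < suc b ] h (2 ^ i * p ^ j)
sum-over-divisors {p} p-prime p-odd a b h = begin
    sum (map h (divisors n))
  ≡⟨ sum-↭ (Perm.map⁺ h (∼bag⇒↭ (unique∧set⇒bag divisors-unique grid-unique (mk⇔ divisor⇒grid grid⇒divisor)))) ⟩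
    sum (map h grid)
  ≡⟨ sum-grid h F (suc a) (suc b) ⟩
    ∑[ i < suc a ] ∑[ j < suc b ] h (2 ^ i * p ^ j) ∎
  where
  open ≡-Reasoning
  n : ℕ
  n = 2 ^ a * p ^ b
  F : ℕ → ℕ → ℕ
  F i j = 2 ^ i * p ^ j
  grid : List ℕ
  grid = cartesianProductWith F (upTo (suc a)) (upTo (suc b))
  instance
    p≢0 : NonZero p
    p≢0 = prime⇒nonZero p-prime
    n≢0 : NonZero n
    n≢0 = m*n≢0 (2 ^ a) (p ^ b) {{m^n≢0 2 a}} {{m^n≢0 p b}}

  divisors-unique : Unique (divisors n)
  divisors-unique = Unique.filter⁺ (_∣? n) (Unique.drop⁺ 1 (Unique.upTo⁺ (suc n)))
  grid-unique : Unique grid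
  grid-unique = Unique.cartesianProductWith⁺ F
    (λ {i} {i'} {j} {j'} → two-odd-powers-injective (nonTrivial⇒n>1 p {{prime⇒nonTrivial p-prime}}) p-odd i i' j j')
    (Unique.upTo⁺ (suc a)) (Unique.upTo⁺ (suc b))

  divisor⇒grid : ∀ {d} → d ∈ divisors n → d ∈ grid
  divisor⇒grid d∈ with two-prime-powers-divisor prime[2] p-prime a b (proj₂ (∈-filter⁻ (_∣? n) {xs = applyUpTo suc n} d∈))
  ... | i , j , i≤a , j≤b , refl = ∈-cartesianProductWith⁺ F (∈-upTo⁺ (s≤s i≤a)) (∈-upTo⁺ (s≤s j≤b))

  positive∈1…n : ∀ d → .{{NonZero d}} → d ≤ n → d ∈ applyUpTo suc n
  positive∈1…n (suc d) d<n = ∈-applyUpTo⁺ suc d<n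

  grid⇒divisor : ∀ {d} → d ∈ grid → d ∈ divisors n
  grid⇒divisor d∈ with ∈-cartesianProductWith⁻ F (upTo (suc a)) (upTo (suc b)) d∈
  ... | i , j , i∈ , j∈ , refl =
    let d∣n = *-pres-∣ (power-divides 2 (≤-pred (∈-upTo⁻ i∈))) (power-divides p (≤-pred (∈-upTo⁻ j∈)))
        instance _ = m*n≢0 (2 ^ i) (p ^ j) {{m^n≢0 2 i}} {{m^n≢0 p j}}
    in ∈-filter⁺ (_∣? n) (positive∈1…n (F i j) (∣⇒≤ d∣n)) d∣n

σ-formula : ∀ {p} → Prime p → p % 2 ≡ 1 → ∀ a b → σ (2 ^ a * p ^ b) ≡ geom 2 (suc a) * geom p (suc b)
σ-formula {p} p-prime p-odd a b = begin
    σ (2 ^ a * p ^ b)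
  ≡⟨ cong sum (sym (map-id (divisors (2 ^ a * p ^ b)))) ⟩
    sum (map (λ d → d) (divisors (2 ^ a * p ^ b)))
  ≡⟨ sum-over-divisors p-prime p-odd a b (λ d → d) ⟩
    ∑[ i < suc a ] ∑[ j < suc b ] 2 ^ i * p ^ j
  ≡⟨ ∑-cong (suc a) (λ i → ∑-*ˡ (suc b) (2 ^ i) (p ^_)) ⟩
    ∑[ i < suc a ] 2 ^ i * geom p (suc b)
  ≡⟨ ∑-*ʳ (suc a) (geom p (suc b)) (2 ^_) ⟩
    geom 2 (suc a) * geom p (suc b) ∎
  where open ≡-Reasoning

-- Used only to evaluate σ(2^m) via the formula for σ(2^a p^b) with b = 0.
prime[3] : Prime 3
prime[3] = from-yes (prime? 3)

power-of-two-deficient : ∀ m → σ (2 ^ m) < 2 * 2 ^ m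
power-of-two-deficient m = begin-strict
    σ (2 ^ m)           ≡⟨ cong σ (sym (*-identityʳ (2 ^ m))) ⟩
    σ (2 ^ m * 3 ^ 0)   ≡⟨ σ-formula prime[3] refl m 0 ⟩
    geom 2 (suc m) * 1  ≡⟨ *-identityʳ _ ⟩
    geom 2 (suc m)      <⟨ m<m+n _ z<s ⟩
    geom 2 (suc m) + 1  ≡⟨ geom-two (suc m) ⟩
    2 * 2 ^ m           ∎
  where open ≤-Reasoning

-- If the odd prime p is at least 2^(a+1) then 2^a p^b is deficient.  With
-- M = σ(2^a), p = q + 1 and g = geom p b (so p^b = qg + 1):
-- σ + (qg + 1) = 2n + Mg, and Mg < qg + 1 because M < p.
large-prime-deficient : ∀ {p} → Prime p → p % 2 ≡ 1 → ∀ a b → 2 ^ suc a ≤ p →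
                        σ (2 ^ a * p ^ b) < 2 * (2 ^ a * p ^ b)
large-prime-deficient {suc q} p-prime p-odd a b 2^a+1≤p =
  +-cancelʳ-< (q * g + 1) (σ n) (2 * n) (begin-strict
    σ n + (q * g + 1)                     ≡⟨ cong (_+ (q * g + 1)) σn≡ ⟩
    M * (1 + suc q * g) + (q * g + 1)     ≡⟨ rearrange M q g ⟩
    (M + 1) * (g * q + 1) + M * g         <⟨ +-monoʳ-< ((M + 1) * (g * q + 1)) Mg<qg+1 ⟩
    (M + 1) * (g * q + 1) + (q * g + 1)   ≡⟨ cong (_+ (q * g + 1)) 2n≡ ⟨
    2 * n + (q * g + 1)                   ∎)
  where
  open ≤-Reasoning
  n M g : ℕ
  n = 2 ^ a * suc q ^ b
  M = geom 2 (suc a)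
  g = geom (suc q) b
  rearrange : ∀ M q g → M * (1 + suc q * g) + (q * g + 1) ≡ (M + 1) * (g * q + 1) + M * g
  rearrange = solve-∀
  σn≡ : σ n ≡ M * (1 + suc q * g)
  σn≡ = trans (σ-formula p-prime p-odd a b) (cong (M *_) (geom-suc (suc q) b))
  2n≡ : 2 * n ≡ (M + 1) * (g * q + 1)
  2n≡ = begin-equality
    2 * (2 ^ a * suc q ^ b)       ≡⟨ *-assoc 2 (2 ^ a) _ ⟨
    2 ^ suc a * suc q ^ b         ≡⟨ cong₂ _*_ (geom-two (suc a)) (geom-closed q b) ⟨
    (M + 1) * (g * q + 1)         ∎
  M≤q : M ≤ q
  M≤q = ≤-pred (subst (_≤ suc q) (trans (sym (geom-two (suc a))) (+-comm M 1)) 2^a+1≤p)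
  Mg<qg+1 : M * g < q * g + 1
  Mg<qg+1 = subst (M * g <_) (+-comm 1 (q * g)) (s≤s (*-monoˡ-≤ g M≤q))

digit : ℕ → ℕ → Bool
digit zero    X = X % 2 ≡ᵇ 1
digit (suc i) X = digit i (X / 2)

lowest-digit : ∀ X → select (X % 2 ≡ᵇ 1) 1 ≡ X % 2
lowest-digit X with X % 2 | m%n<n X 2
... | 0           | _ = refl
... | 1           | _ = refl
... | suc (suc _) | s≤s (s≤s ())

binary-expansion : ∀ m X → X < 2 ^ m → ∑[ i < m ] select (digit i X) (2 ^ i) ≡ X
binary-expansion zero    zero    _        = refl
binary-expansion zero    (suc X) (s≤s ())
binary-expansion (suc m) X       X<2^m+1  = begin
    select (X % 2 ≡ᵇ 1) 1 + (∑[ i < m ] select (digit i (X / 2)) (2 * 2 ^ i))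
  ≡⟨ cong₂ _+_ (lowest-digit X) (trans (∑-cong m (λ i → select-*ˡ (digit i (X / 2)) 2 (2 ^ i)))
                                       (∑-*ˡ m 2 (λ i → select (digit i (X / 2)) (2 ^ i)))) ⟩
    X % 2 + 2 * (∑[ i < m ] select (digit i (X / 2)) (2 ^ i))
  ≡⟨ cong (λ t → X % 2 + 2 * t) (binary-expansion m (X / 2) X/2<2^m) ⟩
    X % 2 + 2 * (X / 2)
  ≡⟨ trans (cong (X % 2 +_) (*-comm 2 (X / 2))) (sym (m≡m%n+[m/n]*n X 2)) ⟩
    X ∎
  where
  open ≡-Reasoning
  X/2<2^m : X / 2 < 2 ^ m
  X/2<2^m = *-cancelʳ-< 2 (X / 2) (2 ^ m)
              (≤-<-trans (m/n*n≤m X 2) (subst (X <_) (*-comm 2 (2 ^ m)) X<2^m+1))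

-- colour f N d: repeatedly halve d (at most f times) down to its odd part o, halving
-- the selector N along the way; the result is then the i-th binary digit of N o,
-- where 2^i is the power of two in d.  N names, for each odd part, the number whose
-- digits say which powers of two go into the first part.
colour : ℕ → (ℕ → ℕ) → ℕ → Bool
colour zero    N d = false
colour (suc f) N d = if d % 2 ≡ᵇ 0 then colour f (λ o → N o / 2) (d / 2) else digit 0 (N d)

colour-even : ∀ f N d → d % 2 ≡ 0 → colour (suc f) N d ≡ colour f (λ o → N o / 2) (d / 2)
colour-even f N d d-even rewrite d-even = refl

colour-double : ∀ f N m → colour (suc f) N (2 * m) ≡ colour f (λ o → N o / 2) m
colour-double f N m = begin
    colour (suc f) N (2 * m)                ≡⟨ cong (colour (suc f) N) (*-comm 2 m) ⟩
    colour (suc f) N (m * 2)                ≡⟨ colour-even f N (m * 2) (m*n%n≡0 m 2) ⟩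
    colour f (λ o → N o / 2) (m * 2 / 2)    ≡⟨ cong (colour f (λ o → N o / 2)) (m*n/n≡m m 2) ⟩
    colour f (λ o → N o / 2) m              ∎
  where open ≡-Reasoning

colour-correct : ∀ f N i o → i < f → o % 2 ≡ 1 → colour f N (2 ^ i * o) ≡ digit i (N o)
colour-correct (suc f) N zero    o _ o-odd rewrite *-identityˡ o | o-odd = refl
colour-correct (suc f) N (suc i) o (s≤s i<f) o-odd = begin
    colour (suc f) N (2 * 2 ^ i * o)      ≡⟨ cong (colour (suc f) N) (*-assoc 2 (2 ^ i) o) ⟩
    colour (suc f) N (2 * (2 ^ i * o))    ≡⟨ colour-double f N (2 ^ i * o) ⟩
    colour f (λ o → N o / 2) (2 ^ i * o)  ≡⟨ colour-correct f (λ o → N o / 2) i o i<f o-odd ⟩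
    digit (suc i) (N o)                   ∎
  where open ≡-Reasoning

-- i < 2^i, so d = 2^i·o is enough fuel to colour d.
exponent<power : ∀ i → i < 2 ^ i
exponent<power zero    = z<s
exponent<power (suc i) = begin-strict
  suc i            ≤⟨ exponent<power i ⟩
  2 ^ i            <⟨ m<m+n (2 ^ i) (m^n>0 2 i) ⟩
  2 ^ i + 2 ^ i    ≡⟨ cong (2 ^ i +_) (+-identityʳ (2 ^ i)) ⟨
  2 ^ suc i        ∎
  where open ≤-Reasoning

module Partition (q α k : ℕ) (p-prime : Prime (2 + q)) (p-odd : (2 + q) % 2 ≡ 1)
                 (p<2^α+1 : 2 + q < 2 ^ suc α) where

  p : ℕ
  p = 2 + q

  n : ℕ
  n = 2 ^ α * p ^ (1 + 2 * k)

  M : ℕ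
  M = geom 2 (suc α)

  h : ℕ
  h = p / 2

  -- T = σ(2^α)(p + 1)/2, so that σ(n) = 2TS.
  T : ℕ
  T = M * suc h

  X : ℕ
  X = T / p

  Y : ℕ
  Y = T % p

  S : ℕ
  S = geom (p * p) (suc k)

  p-halves : p ≡ 1 + h * 2
  p-halves = trans (m≡m%n+[m/n]*n p 2) (cong (_+ h * 2) p-odd)

  T-division : T ≡ Y + X * p
  T-division = m≡m%n+[m/n]*n T p

  Y<2^α+1 : Y < 2 ^ suc α
  Y<2^α+1 = <-trans (m%n<n T p) p<2^α+1

  X<2^α+1 : X < 2 ^ suc α
  X<2^α+1 = *-cancelʳ-< p X (2 ^ suc α) (begin-strict
      X * p                    ≤⟨ m/n*n≤m T p ⟩
      T                        <⟨ m<m+n T z<s ⟩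
      T + suc (M * h + h * 2)  ≡⟨ expand M h ⟩
      (M + 1) * (1 + h * 2)    ≡⟨ cong₂ _*_ (geom-two (suc α)) (sym p-halves) ⟩
      2 ^ suc α * p            ∎)
    where
    open ≤-Reasoning
    expand : ∀ M h → M * suc h + suc (M * h + h * 2) ≡ (M + 1) * (1 + h * 2)
    expand = solve-∀

  -- The selector: odd parts ≡ 1 (mod p + 1), among them the p^j with j even, read
  -- their digits from Y; the others, among them the p^j with j odd, from X.
  N : ℕ → ℕ
  N o = if o % suc p ≡ᵇ 1 then Y else X

  c : ℕ → Bool
  c d = colour d N d

  -- p² ≡ 1 (mod p + 1).
  residue-period : ∀ j → p ^ (2 + j) % suc p ≡ p ^ j % suc p
  residue-period j = trans (cong (_% suc p) (square (suc q) (p ^ j)))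
                           ([m+kn]%n≡m%n (p ^ j) (p ^ j * suc q) (suc p))
    where
    square : ∀ r x → suc r * (suc r * x) ≡ x + x * r * suc (suc r)
    square = solve-∀

  N-period : ∀ j → N (p ^ (2 + j)) ≡ N (p ^ j)
  N-period j = cong (λ x → if x ≡ᵇ 1 then Y else X) (residue-period j)

  N-p : N (p ^ 1) ≡ X
  N-p = cong (λ x → if x ≡ᵇ 1 then Y else X)
             (trans (cong (_% suc p) (*-identityʳ p)) (m<n⇒m%n≡m (n<1+n p)))

  c-on-divisor : ∀ i j → c (2 ^ i * p ^ j) ≡ digit i (N (p ^ j))
  c-on-divisor i j = colour-correct (2 ^ i * p ^ j) N i (p ^ j)
    (<-≤-trans (exponent<power i) (m≤m*n (2 ^ i) (p ^ j) {{m^n≢0 p j}})) (odd-power p-odd j)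

  chosen : ℕ → ℕ → ℕ
  chosen i j = select (digit i (N (p ^ j))) (2 ^ i)

  first-part : sumWhere c true (divisors n) ≡ T * S
  first-part = begin
      sumWhere c true (divisors n)
    ≡⟨ sumWhere-true c (divisors n) ⟩
      sum (map (λ d → select (c d) d) (divisors n))
    ≡⟨ sum-over-divisors p-prime p-odd α (1 + 2 * k) _ ⟩
      ∑[ i < suc α ] ∑[ j < 2 + 2 * k ] select (c (2 ^ i * p ^ j)) (2 ^ i * p ^ j)
    ≡⟨ ∑-cong (suc α) (λ i → ∑-cong (2 + 2 * k) (λ j →
         trans (cong (λ b → select b (2 ^ i * p ^ j)) (c-on-divisor i j)) (select-*ʳ _ (2 ^ i) (p ^ j)))) ⟩
      ∑[ i < suc α ] ∑[ j < 2 + 2 * k ] chosen i j * p ^ j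
    ≡⟨ ∑-cong (suc α) (λ i → ∑-period-two p (chosen i)
         (λ j → cong (λ x → select (digit i x) (2 ^ i)) (N-period j)) k) ⟩
      ∑[ i < suc α ] (chosen i 0 + chosen i 1 * p) * S
    ≡⟨ ∑-affine (suc α) (λ i → chosen i 0) (λ i → chosen i 1) p S ⟩
      ((∑[ i < suc α ] chosen i 0) + (∑[ i < suc α ] chosen i 1) * p) * S
    ≡⟨ cong₂ (λ y x → (y + x * p) * S)
         (binary-expansion (suc α) Y Y<2^α+1)
         (trans (∑-cong (suc α) (λ i → cong (λ x → select (digit i x) (2 ^ i)) N-p))
                (binary-expansion (suc α) X X<2^α+1)) ⟩
      (Y + X * p) * S
    ≡⟨ cong (_* S) T-division ⟨
      T * S ∎
    where open ≡-Reasoning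

  σ-value : σ n ≡ 2 * (T * S)
  σ-value = begin
      σ n
    ≡⟨ σ-formula p-prime p-odd α (1 + 2 * k) ⟩
      M * geom p (2 + 2 * k)
    ≡⟨ cong (M *_) (trans (∑-cong (2 + 2 * k) (λ j → sym (*-identityˡ (p ^ j))))
                          (∑-period-two p (λ _ → 1) (λ _ → refl) k)) ⟩
      M * ((1 + 1 * p) * S)
    ≡⟨ cong (λ x → M * ((1 + 1 * x) * S)) p-halves ⟩
      M * ((1 + 1 * (1 + h * 2)) * S)
    ≡⟨ regroup M h S ⟩
      2 * (T * S) ∎
    where
    open ≡-Reasoning
    regroup : ∀ M h S → M * ((1 + 1 * (1 + h * 2)) * S) ≡ 2 * (M * suc h * S)
    regroup = solve-∀

  zumkeller : Zumkeller n
  zumkeller = half-part⇒zumkeller n c (trans (cong (2 *_) first-part) (sym σ-value))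

-- Abundance rules out p = 2 and p ≥ 2^(α+1); in the remaining case the partition exists.
abundant⇒zumkeller : ∀ p α k → Prime p → 1 < p →
  σ (2 ^ α * p ^ (1 + 2 * k)) ≥ 2 * (2 ^ α * p ^ (1 + 2 * k)) → Zumkeller (2 ^ α * p ^ (1 + 2 * k))
abundant⇒zumkeller (suc (suc q)) α k p-prime (s≤s (s≤s _)) abundant with 2 + q ≟ 2
... | yes refl = ⊥-elim (<⇒≱ (subst (λ m → σ m < 2 * m) (^-distribˡ-+-* 2 α (1 + 2 * k))
                                   (power-of-two-deficient (α + (1 + 2 * k)))) abundant)
... | no p≢2 with 2 + q <? 2 ^ suc α
...   | yes p<2^α+1 = Partition.zumkeller q α k p-prime (odd-prime p-prime p≢2) p<2^α+1
...   | no p≮2^α+1  = ⊥-elim (<⇒≱ (large-prime-deficient p-prime (odd-prime p-prime p≢2) α (1 + 2 * k)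
                                     (≮⇒≥ p≮2^α+1)) abundant)

mainTheorem4 : (p α β : ℕ) → Prime p → α ≥ 1 → β ≥ 1 → Odd β →
               Zumkeller (2 ^ α * p ^ β) ⇔ (σ (2 ^ α * p ^ β) ≥ 2 * (2 ^ α * p ^ β))
mainTheorem4 p α _ p-prime _ _ (k , refl) =
  mk⇔ (zumkeller⇒abundant (2 ^ α * p ^ (1 + 2 * k)))
      (abundant⇒zumkeller p α k p-prime (nonTrivial⇒n>1 p {{prime⇒nonTrivial p-prime}}))
  where
  instance
    n≢0 : NonZero (2 ^ α * p ^ (1 + 2 * k))
    n≢0 = m*n≢0 (2 ^ α) (p ^ (1 + 2 * k)) {{m^n≢0 2 α}} {{m^n≢0 p (1 + 2 * k) {{prime⇒nonZero p-prime}}}}
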